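{- Let $T$ be a finite tree and let $\mathcal{F}_{S}(T)$ be the set of connected components of the forest $T\langle N[\operatorname{Supp}(T)]\rangle$. Then $\mathcal{F}_{S}(T)$ is either empty or every member $S\in\mathcal{F}_{S}(T)$ is an S-tree.
   Context: For a graph $G$, $\mathcal{N}(G)$ denotes the null space of its adjacency matrix $A(G)$, viewed as a subspace of $\mathbb{R}^{V(G)}$. For a tree $T$, $\operatorname{Supp}(T)=\{v\in V(T): x_v\neq 0 \text{ for some } x\in\mathcal{N}(T)\}$ (the support of the null space). For $X\subseteq V(G)$, $N(X)=\bigcup_{u\in X}N(u)$ and $N[X]=\bigcup_{u\in X}N[u]$, where $N(u)$ is the set of neighbours of $u$ and $N[u]=N(u)\cup\{u\}$. $G\langle X\rangle$ is the subgraph induced by $X$. A tree $S$ is an S-tree if $N[\operatorname{Supp}(S)]=V(S)$.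
   Formalization: The null spaces that define $\operatorname{Supp}(T)$ and $\operatorname{Supp}(S)$ are taken over ℚ in place of ℝ. -}

module Defs where

open import Data.Nat using (ℕ; zero; suc; _≤_)
open import Data.Fin using (Fin; zero; suc)
open import Data.Bool using (Bool; false; if_then_else_; T)
open import Data.Rational using (ℚ; 0ℚ; _+_)
open import Data.List using (List; []; _∷_; _++_; length)
open import Data.List.Relation.Unary.All using (All)
open import Data.List.Relation.Unary.Unique.Propositional using (Unique)
open import Data.Product using (Σ; ∃; _×_)
open import Data.Sum using (_⊎_)
open import Data.Unit using (⊤)
open import Relation.Binary.PropositionalEquality using (_≡_; _≢_)
open import Relation.Nullary using (¬_)

record Graph (n : ℕ) : Set where
  field
    adj    : Fin n → Fin n → Bool
    adj-sym    : ∀ i j → adj i j ≡ adj j i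
    adj-irrefl : ∀ i → adj i i ≡ false
open Graph public

module _ {n : ℕ} (G : Graph n) where

  Adj : Fin n → Fin n → Set
  Adj i j = T (adj G i j)

  -- Vertex subsets are predicates on Fin n; a subset U stands for the
  -- induced subgraph G⟨U⟩.
  VSet : Set₁
  VSet = Fin n → Set

  Full : VSet
  Full _ = ⊤

  data Walk (U : VSet) : Fin n → Fin n → Set where
    here : ∀ {u} → U u → Walk U u u
    step : ∀ {u w v} → U u → Adj u w → Walk U w v → Walk U u v

  Connected : VSet → Set
  Connected U = ∀ u v → U u → U v → Walk U u v

  Chain : List (Fin n) → Set
  Chain []            = ⊤
  Chain (x ∷ [])      = ⊤
  Chain (x ∷ y ∷ xs)  = Adj x y × Chain (y ∷ xs)

  HasCycle : VSet → Set
  HasCycle U = Σ (Fin n) λ v0 → Σ (List (Fin n)) λ rest →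
    (3 ≤ length (v0 ∷ rest)) × Unique (v0 ∷ rest) × All U (v0 ∷ rest)
    × Chain (v0 ∷ rest ++ v0 ∷ [])

  IsTree : VSet → Set
  IsTree U = (∃ λ u → U u) × Connected U × ¬ HasCycle U

  sumFin : ∀ {m} → (Fin m → ℚ) → ℚ
  sumFin {zero}  f = 0ℚ
  sumFin {suc m} f = f zero + sumFin (λ i → f (suc i))

  -- x ∈ 𝒩(G⟨U⟩): x is a vector on V(G⟨U⟩) (extended by 0 outside U)
  -- with A(G⟨U⟩) x = 0.
  NullVec : VSet → (Fin n → ℚ) → Set
  NullVec U x = (∀ v → ¬ U v → x v ≡ 0ℚ)
              × (∀ i → U i → sumFin (λ j → if adj G i j then x j else 0ℚ) ≡ 0ℚ)

  Supp : VSet → VSet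
  Supp U v = U v × Σ (Fin n → ℚ) λ x → NullVec U x × x v ≢ 0ℚ

  ClosedNbhd : VSet → VSet → VSet
  ClosedNbhd U X v = U v × Σ (Fin n) λ u → X u × U u × (u ≡ v ⊎ Adj u v)

  IsComponent : VSet → VSet → Set
  IsComponent W S = (∃ λ u → S u) × (∀ v → S v → W v) × Connected S
                  × (∀ u w → S u → W w → Adj u w → S w)

  IsSTree : VSet → Set
  IsSTree S = IsTree S
            × (∀ v → ClosedNbhd S (Supp S) v → S v)
            × (∀ v → S v → ClosedNbhd S (Supp S) v)

{-# OPTIONS --safe #-}
module Submission where

-- Let S be a component of T⟨N[Supp T]⟩ and x a null vector of T with
-- x u ≠ 0 for some u in S.  An edge with a nonzero endpoint has both ends
-- in N[Supp T], so the vertices reachable from u along such edges stay in S.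
-- Restricting x to this set keeps it in the null space: a row never sees
-- both a kept and a discarded nonzero entry.  Hence Supp T ∩ S ⊆ Supp S,
-- which gives S ⊆ N[Supp S]; and S is a tree as a connected part of T.

open import Defs
open import Data.Nat using (ℕ; zero; suc)
open import Data.Sum using (_⊎_; inj₁; inj₂)
open import Data.Product using (∃-syntax; _×_; _,_; proj₁; proj₂)
open import Data.Unit using (tt)
open import Data.Bool using (true; false; T; if_then_else_)
open import Data.Fin using (Fin; zero; suc)
open import Data.Fin.Properties using (any?)
open import Data.Fin.Subset using (Subset; _∈_; _∉_; _⊆_; _⊂_; _⊃_; _∪_; ⁅_⁆)
open import Data.Fin.Subset.Properties
  using (_∈?_; ⊆-trans; p⊆p∪q; x∈p∪q⁺; x∈p∪q⁻; x∈⁅x⁆; x∈⁅y⁆⇒x≡y)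
open import Data.Fin.Subset.Induction using (⊃-wellFounded)
open import Data.Rational using (ℚ; 0ℚ; _+_)
import Data.Rational.Properties as ℚ
open import Data.List.Relation.Unary.All as All using ()
open import Function using (_∘_)
open import Induction.WellFounded using (Acc; acc)
open import Relation.Binary.Core using (Rel)
open import Relation.Binary.Definitions using (Decidable; _Respects_)
open import Relation.Binary.PropositionalEquality
  using (_≡_; _≢_; refl; sym; trans; subst; cong₂)
open import Relation.Nullary using (¬_; Dec; yes; no; does; ¬?; _×-dec_; _⊎-dec_; contradiction)
open import Relation.Nullary.Decidable using (T?; decidable-stable)
open import Relation.Unary using (Pred)

module Closure {n r} {R : Rel (Fin n) r} (R? : Decidable R) where

  private
    Exit : Subset n → Set r
    Exit p = ∃[ i ] ∃[ j ] i ∈ p × R i j × j ∉ p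

    exit? : ∀ p → Dec (Exit p)
    exit? p = any? λ i → any? λ j → (i ∈? p) ×-dec R? i j ×-dec ¬? (j ∈? p)

    no-exit⇒respects : ∀ {p} → ¬ Exit p → (_∈ p) Respects R
    no-exit⇒respects {p} ¬exit {i} {j} Rij i∈p with j ∈? p
    ... | yes j∈p = j∈p
    ... | no  j∉p = contradiction (i , j , i∈p , Rij , j∉p) ¬exit

    ⊂-insert : ∀ {p : Subset n} {j} → j ∉ p → p ⊂ p ∪ ⁅ j ⁆
    ⊂-insert {p} {j} j∉p = p⊆p∪q ⁅ j ⁆ , j , x∈p∪q⁺ (inj₂ (x∈⁅x⁆ j)) , j∉p

    insert-within : ∀ {ℓ} {P : Pred (Fin n) ℓ} {p : Subset n} {j} →
      (∀ {i} → i ∈ p → P i) → P j → ∀ {k} → k ∈ p ∪ ⁅ j ⁆ → P k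
    insert-within {P = P} {p} {j} p⊆P Pj k∈ with x∈p∪q⁻ p ⁅ j ⁆ k∈
    ... | inj₁ k∈p = p⊆P k∈p
    ... | inj₂ k∈j = subst P (sym (x∈⁅y⁆⇒x≡y j k∈j)) Pj

  -- Reachability is not decidable by itself; the closure is built as a Subset,
  -- adding one escaping successor at a time, so that vectors can be restricted to it.
  closure-within : ∀ {ℓ} {P : Pred (Fin n) ℓ} → P Respects R →
    ∀ p → (∀ {i} → i ∈ p → P i) →
    ∃[ q ] p ⊆ q × (_∈ q) Respects R × (∀ {i} → i ∈ q → P i)
  closure-within {P = P} P-resp p = go p (⊃-wellFounded p)
    where
    go : ∀ p → Acc _⊃_ p → (∀ {i} → i ∈ p → P i) →
         ∃[ q ] p ⊆ q × (_∈ q) Respects R × (∀ {i} → i ∈ q → P i)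
    go p (acc rec) p⊆P with exit? p
    ... | no ¬exit = p , (λ i∈p → i∈p) , no-exit⇒respects ¬exit , p⊆P
    ... | yes (i , j , i∈p , Rij , j∉p)
      with go (p ∪ ⁅ j ⁆) (rec (⊂-insert j∉p)) (insert-within p⊆P (P-resp Rij (p⊆P i∈p)))
    ... | q , p∪j⊆q , q-resp , q⊆P = q , ⊆-trans (p⊆p∪q ⁅ j ⁆) p∪j⊆q , q-resp , q⊆P

module NullSpace {n} (G : Graph n) where

  Adj-sym : ∀ {i j} → Adj G i j → Adj G j i
  Adj-sym {i} {j} = subst T (adj-sym G i j)

  SupportEdge : (Fin n → ℚ) → Rel (Fin n) _
  SupportEdge x i j = Adj G i j × (x i ≢ 0ℚ ⊎ x j ≢ 0ℚ)

  SupportEdge? : ∀ x → Decidable (SupportEdge x)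
  SupportEdge? x i j = T? (adj G i j) ×-dec (¬? (x i ℚ.≟ 0ℚ) ⊎-dec ¬? (x j ℚ.≟ 0ℚ))

  _↾_ : (Fin n → ℚ) → Subset n → Fin n → ℚ
  (x ↾ q) j = if does (j ∈? q) then x j else 0ℚ

  ↾-∈ : ∀ x {q j} → j ∈ q → (x ↾ q) j ≡ x j
  ↾-∈ x {q} {j} j∈q with j ∈? q
  ... | yes _   = refl
  ... | no  j∉q = contradiction j∈q j∉q

  ↾-∉ : ∀ x {q j} → j ∉ q → (x ↾ q) j ≡ 0ℚ
  ↾-∉ x {q} {j} j∉q with j ∈? q
  ... | yes j∈q = contradiction j∈q j∉q
  ... | no  _   = refl

  sumFin-cong : ∀ {m} {f g : Fin m → ℚ} → (∀ j → f j ≡ g j) → sumFin G f ≡ sumFin G g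
  sumFin-cong {zero}  f≗g = refl
  sumFin-cong {suc m} f≗g = cong₂ _+_ (f≗g zero) (sumFin-cong (f≗g ∘ suc))

  sumFin-zero : ∀ {m} {f : Fin m → ℚ} → (∀ j → f j ≡ 0ℚ) → sumFin G f ≡ 0ℚ
  sumFin-zero {zero}  f≗0 = refl
  sumFin-zero {suc m} f≗0 =
    trans (cong₂ _+_ (f≗0 zero) (sumFin-zero (f≗0 ∘ suc))) (ℚ.+-identityʳ 0ℚ)

  masked-cong : ∀ b {a c : ℚ} → (T b → a ≡ c) → (if b then a else 0ℚ) ≡ (if b then c else 0ℚ)
  masked-cong true  a≡c = a≡c tt
  masked-cong false a≡c = refl

  masked-zero : ∀ b {a : ℚ} → (T b → a ≡ 0ℚ) → (if b then a else 0ℚ) ≡ 0ℚ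
  masked-zero true  a≡0 = a≡0 tt
  masked-zero false a≡0 = refl

  module _ {x : Fin n → ℚ} {q : Subset n} (q-resp : (_∈ q) Respects SupportEdge x) where

    boundary-vanishes : ∀ {i j} → i ∈ q → j ∉ q → Adj G i j → x i ≡ 0ℚ × x j ≡ 0ℚ
    boundary-vanishes {i} {j} i∈q j∉q a =
        decidable-stable (x i ℚ.≟ 0ℚ) (λ xi≢0 → j∉q (q-resp (a , inj₁ xi≢0) i∈q))
      , decidable-stable (x j ℚ.≟ 0ℚ) (λ xj≢0 → j∉q (q-resp (a , inj₂ xj≢0) i∈q))

    ↾-agrees-near : ∀ {i j} → i ∈ q → Adj G i j → (x ↾ q) j ≡ x j
    ↾-agrees-near {j = j} i∈q a with j ∈? q
    ... | yes _   = refl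
    ... | no  j∉q = sym (proj₂ (boundary-vanishes i∈q j∉q a))

    ↾-vanishes-near : ∀ {i j} → i ∉ q → Adj G i j → (x ↾ q) j ≡ 0ℚ
    ↾-vanishes-near {j = j} i∉q a with j ∈? q
    ... | yes j∈q = proj₁ (boundary-vanishes j∈q i∉q (Adj-sym a))
    ... | no  _   = refl

    ↾-null : ∀ {U} → NullVec G (Full G) x → (∀ {v} → v ∈ q → U v) → NullVec G U (x ↾ q)
    ↾-null (_ , x-rows) q⊆U = (λ v ¬Uv → ↾-∉ x (¬Uv ∘ q⊆U)) , rows
      where
      rows : ∀ i → _ → sumFin G (λ j → if adj G i j then (x ↾ q) j else 0ℚ) ≡ 0ℚ
      rows i _ with i ∈? q
      ... | yes i∈q = trans (sumFin-cong λ j → masked-cong (adj G i j) (↾-agrees-near i∈q))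
                            (x-rows i tt)
      ... | no  i∉q = sumFin-zero λ j → masked-zero (adj G i j) (↾-vanishes-near i∉q)

module Components {n} (G : Graph n) where

  open NullSpace G
  open Closure

  N[Supp] : VSet G
  N[Supp] = ClosedNbhd G (Full G) (Supp G (Full G))

  Supp⊆N[Supp] : ∀ {u} → Supp G (Full G) u → N[Supp] u
  Supp⊆N[Supp] {u} u∈Supp = tt , u , u∈Supp , tt , inj₁ refl

  Adj-Supp⇒N[Supp] : ∀ {u v} → Supp G (Full G) u → Adj G u v → N[Supp] v
  Adj-Supp⇒N[Supp] {u} u∈Supp a = tt , u , u∈Supp , tt , inj₂ a

  module _ {S : VSet G} (comp : IsComponent G N[Supp] S) where

    private
      S⊆N[Supp] : ∀ v → S v → N[Supp] v
      S⊆N[Supp] = proj₁ (proj₂ comp)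

      S-extends : ∀ u w → S u → N[Supp] w → Adj G u w → S w
      S-extends = proj₂ (proj₂ (proj₂ comp))

    component-respects-SupportEdge : ∀ {x} → NullVec G (Full G) x → S Respects SupportEdge x
    component-respects-SupportEdge {x} null {i} {j} (a , inj₁ xi≢0) Si =
      S-extends i j Si (Adj-Supp⇒N[Supp] (tt , x , null , xi≢0) a) a
    component-respects-SupportEdge {x} null {i} {j} (a , inj₂ xj≢0) Si =
      S-extends i j Si (Supp⊆N[Supp] (tt , x , null , xj≢0)) a

    Supp-component : ∀ {u} → S u → Supp G (Full G) u → Supp G S u
    Supp-component {u} Su (_ , x , null , xu≢0)
      with closure-within (SupportEdge? x) (component-respects-SupportEdge null) ⁅ u ⁆
             (λ i∈u → subst S (sym (x∈⁅y⁆⇒x≡y u i∈u)) Su)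
    ... | q , u∈q , q-resp , q⊆S = Su , x ↾ q , ↾-null q-resp null q⊆S , x↾q-u≢0
      where
      x↾q-u≢0 : (x ↾ q) u ≢ 0ℚ
      x↾q-u≢0 eq = xu≢0 (trans (sym (↾-∈ x (u∈q (x∈⁅x⁆ u)))) eq)

    component-covered : ∀ {v} → S v → ClosedNbhd G S (Supp G S) v
    component-covered {v} Sv with S⊆N[Supp] v Sv
    ... | _ , u , u∈Supp , _ , inj₁ refl = Sv , u , Supp-component Sv u∈Supp , Sv , inj₁ refl
    ... | _ , u , u∈Supp , _ , inj₂ a   = Sv , u , Supp-component Su u∈Supp , Su , inj₂ a
      where Su = S-extends v u Sv (Supp⊆N[Supp] u∈Supp) (Adj-sym a)

HasCycle-mono : ∀ {n} (G : Graph n) {U V : VSet G} →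
  (∀ {v} → U v → V v) → HasCycle G U → HasCycle G V
HasCycle-mono G U⊆V (v₀ , rest , len , uniq , inU , chain) =
  v₀ , rest , len , uniq , All.map U⊆V inU , chain

component-isSTree : ∀ {n} (G : Graph n) → IsTree G (Full G) →
  ∀ {S} → IsComponent G (Components.N[Supp] G) S → IsSTree G S
component-isSTree G (_ , _ , acyclic) comp@(nonempty , _ , connected , _) =
    (nonempty , connected , acyclic ∘ HasCycle-mono G _)
  , (λ v → proj₁)
  , (λ v → Components.component-covered G comp)

mainTheorem1 : (n : ℕ) (T : Graph n) → IsTree T (Full T) →
    (∀ S → ¬ IsComponent T (ClosedNbhd T (Full T) (Supp T (Full T))) S)
    ⊎ (∀ S → IsComponent T (ClosedNbhd T (Full T) (Supp T (Full T))) S → IsSTree T S)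
mainTheorem1 n T tree = inj₂ λ S → component-isSTree T tree
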